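{- Let $\mathsf{F}$ be a labeled forest which is the disjoint union of the trees $\mathsf{T}_1,\dots,\mathsf{T}_m$. Then $G_{\mathsf{F}}\cong G_{\mathsf{T}_1}\times\cdots\times G_{\mathsf{T}_m}$.
   Context: A forest is a finite acyclic graph, a tree is a connected forest. A path in a graph is a sequence of pairwise distinct vertices $v_1,\dots,v_m$ with $v_i$ adjacent to $v_{i+1}$ for all $i$; it is maximal if it is not strictly contained in another path. For a forest (or tree) $\mathsf{F}$ whose vertices are labeled by distinct positive integers (for $\mathsf{F}$ itself, by $[n]$ where $n$ is its number of vertices), its chain group $G_{\mathsf{F}}$ is the group of permutations of its vertex labels generated by all cycles $(i_1\ i_2\ \cdots\ i_m)$ such that $i_1,\dots,i_m$ is a maximal path of $\mathsf{F}$ (a one-vertex path gives the identity). Each $\mathsf{T}_j$ carries the labels it inherits from $\mathsf{F}$. -}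

module Defs where

open import Level using (0ℓ)
open import Data.Nat using (ℕ; suc; _≤_)
open import Data.Fin using (Fin)
import Data.Fin.Properties as FinP
open import Data.List using (List; []; _∷_; length)
open import Data.List.Membership.Propositional using (_∈_; _∉_)
open import Data.List.Relation.Unary.Unique.Propositional using (Unique)
open import Data.Product using (Σ; ∃; ∃-syntax; _×_; _,_; proj₁)
import Data.Product.Properties as ProdP
open import Data.Unit using (⊤)
open import Function using (id; _∘_)
open import Relation.Nullary using (¬_; yes; no)
open import Relation.Binary.Definitions using (DecidableEquality)
open import Relation.Binary.PropositionalEquality using (_≡_; _≗_)
import Axiom.UniquenessOfIdentityProofs as UIP

record Graph (V : Set) : Set₁ where
  field
    Adj    : V → V → Set
    sym    : ∀ {u v} → Adj u v → Adj v u
    irrefl : ∀ {v} → ¬ Adj v v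
open Graph public

module _ {V : Set} (G : Graph V) where

  Linked : List V → Set
  Linked []            = ⊤
  Linked (x ∷ [])      = ⊤
  Linked (x ∷ y ∷ xs)  = Adj G x y × Linked (y ∷ xs)

  data NonEmpty : List V → Set where
    nonEmpty : ∀ {x xs} → NonEmpty (x ∷ xs)

  IsPath : List V → Set
  IsPath p = NonEmpty p × Unique p × Linked p

  IsMaximalPath : List V → Set
  IsMaximalPath p =
    IsPath p ×
    ¬ (Σ (List V) λ q → IsPath q × (∀ {v} → v ∈ p → v ∈ q) × ∃[ w ] (w ∈ q × w ∉ p))

  lastOr : V → List V → V
  lastOr d []       = d
  lastOr d (x ∷ xs) = lastOr x xs

  HasCycle : Set
  HasCycle = Σ V λ v → Σ (List V) λ vs →
    IsPath (v ∷ vs) × 3 ≤ length (v ∷ vs) × Adj G (lastOr v vs) v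

  IsForest : Set
  IsForest = ¬ HasCycle

  Connected : Set
  Connected = ∀ u v → Σ (List V) λ vs → IsPath (u ∷ vs) × lastOr u vs ≡ v

  IsTree : Set
  IsTree = IsForest × Connected

module _ {V : Set} (_≟_ : DecidableEquality V) where

  private
    go : V → V → List V → V → V
    go first x []      v with v ≟ x
    ... | yes _ = first
    ... | no  _ = v
    go first x (y ∷ r) v with v ≟ x
    ... | yes _ = y
    ... | no  _ = go first y r v

  -- cycle p sends p[k] ↦ p[k+1], last ↦ first, fixes all other vertices
  cycle : List V → V → V
  cycle []       = id
  cycle (a ∷ as) = go a a as

  -- the chain group G_F, as the subgroup of the permutations of V
  -- generated by the cycles of the maximal paths of F
  -- (elements are maps V → V, considered up to pointwise equality)
  data InChainGroup (F : Graph V) : (V → V) → Set where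
    gen  : ∀ p → IsMaximalPath F p → InChainGroup F (cycle p)
    one  : InChainGroup F id
    comp : ∀ {f g} → InChainGroup F f → InChainGroup F g → InChainGroup F (f ∘ g)
    inv  : ∀ {f g} → InChainGroup F f → f ∘ g ≗ id → g ∘ f ≗ id → InChainGroup F g
    ext  : ∀ {f g} → InChainGroup F f → f ≗ g → InChainGroup F g

  ChainGroup : Graph V → Set
  ChainGroup F = Σ (V → V) (InChainGroup F)

  _·_ : ∀ {F} → ChainGroup F → ChainGroup F → ChainGroup F
  (f , pf) · (g , pg) = (f ∘ g , comp pf pg)

-- the vertex set of the j-th part of c : Fin n → Fin m, with inherited labels
Part : ∀ {n m} → (Fin n → Fin m) → Fin m → Set
Part {n} c j = Σ (Fin n) λ v → c v ≡ j

Part-≟ : ∀ {n m} (c : Fin n → Fin m) (j : Fin m) → DecidableEquality (Part c j)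
Part-≟ c j = ProdP.≡-dec FinP._≟_ (λ p q → yes (UIP.Decidable⇒UIP.≡-irrelevant FinP._≟_ p q))

induced : ∀ {n m} → Graph (Fin n) → (c : Fin n → Fin m) → (j : Fin m) → Graph (Part c j)
induced F c j = record
  { Adj    = λ u v → Adj F (proj₁ u) (proj₁ v)
  ; sym    = sym F
  ; irrefl = irrefl F
  }

module _ {n m : ℕ} (F : Graph (Fin n)) (c : Fin n → Fin m) where

  GF : Set
  GF = ChainGroup FinP._≟_ F

  GT : Fin m → Set
  GT j = ChainGroup (Part-≟ c j) (induced F c j)

  Product : Set
  Product = (j : Fin m) → GT j

  _≈F_ : GF → GF → Set
  x ≈F y = proj₁ x ≗ proj₁ y

  _≈P_ : Product → Product → Set
  x ≈P y = ∀ j → proj₁ (x j) ≗ proj₁ (y j)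

  _·P_ : Product → Product → Product
  (x ·P y) j = _·_ (Part-≟ c j) (x j) (y j)

  record ChainGroupIso : Set where
    field
      to         : GF → Product
      to-cong    : ∀ {x y} → x ≈F y → to x ≈P to y
      homo       : ∀ x y → to (_·_ FinP._≟_ x y) ≈P (to x ·P to y)
      injective  : ∀ {x y} → to x ≈P to y → x ≈F y
      surjective : ∀ z → Σ GF λ x → to x ≈P z

-- Colour every vertex of F by the index c v of the tree containing it.  The
-- only property of c the argument uses is that adjacent vertices have equal
-- colour.  A path of
-- F is then monochrome, so it is (the image of) a path of one part, and it is
-- maximal in F exactly when it is maximal in that part.  Hence every
-- generator of G_F is the extension by the identity of a generator of some
-- G_{T_j}.  From this:
--   * every element of G_F preserves colours, so it restricts to each part,
--     and the restriction to part j lies in G_{T_j};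
--   * extension by the identity maps G_{T_j} into G_F;
--   * a family (g_j) is glued to the permutation acting as g_j on part j,
--     which is the product of the extensions of the g_j, hence lies in G_F.
-- Restriction to all parts is therefore a homomorphism G_F → ∏ G_{T_j} that
-- is injective (the parts cover the vertices) and surjective (by gluing).
module Submission where

open import Defs
open import Data.Nat using (ℕ)
open import Data.Fin using (Fin)
open import Data.Product using (∃-syntax)
open import Relation.Binary.PropositionalEquality using (_≡_)

import Data.Fin.Properties as FinP
open import Data.List using (List; []; _∷_; map; allFin)
open import Data.List.Membership.Propositional using (_∈_; _∉_)
open import Data.List.Membership.Propositional.Properties using (∈-map⁺; ∈-map⁻; ∈-allFin)
open import Data.List.Relation.Binary.Subset.Propositional using (_⊆_)
import Data.List.Relation.Binary.Subset.Propositional.Properties as Subset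
open import Data.List.Relation.Unary.All as All using (All)
open import Data.List.Relation.Unary.Any using (here; there)
open import Data.List.Relation.Unary.AllPairs using (_∷_)
open import Data.List.Relation.Unary.Unique.Propositional using (Unique)
import Data.List.Relation.Unary.Unique.Propositional.Properties as UniqueP
open import Data.Product using (Σ; _×_; _,_; proj₁; proj₂)
open import Data.Empty using (⊥-elim)
open import Function using (id; _∘_)
open import Relation.Nullary using (¬_; Dec; yes; no)
open import Relation.Binary.Definitions using (DecidableEquality)
open import Relation.Binary.PropositionalEquality
  using (refl; trans; cong; subst; _≗_; _≢_)
  renaming (sym to ≡-sym)
import Axiom.UniquenessOfIdentityProofs as UIP

module CycleEquations {V : Set} (_≟_ : DecidableEquality V) where

  singleton : ∀ {a v} → cycle _≟_ (a ∷ []) v ≡ v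
  singleton {a} {v} with v ≟ a
  ... | yes v≡a = ≡-sym v≡a
  ... | no  _   = refl

  at-head : ∀ {a b r v} → v ≡ a → cycle _≟_ (a ∷ b ∷ r) v ≡ b
  at-head {a} {v = v} v≡a with v ≟ a
  ... | yes _   = refl
  ... | no  v≢a = ⊥-elim (v≢a v≡a)

  pair-at-second : ∀ {a b v} → v ≢ a → v ≡ b → cycle _≟_ (a ∷ b ∷ []) v ≡ a
  pair-at-second {a} {b} {v} v≢a v≡b with v ≟ a
  ... | yes v≡a = ⊥-elim (v≢a v≡a)
  ... | no  _ with v ≟ b
  ...   | yes _   = refl
  ...   | no  v≢b = ⊥-elim (v≢b v≡b)

  pair-off : ∀ {a b v} → v ≢ a → v ≢ b → cycle _≟_ (a ∷ b ∷ []) v ≡ v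
  pair-off {a} {b} {v} v≢a v≢b with v ≟ a
  ... | yes v≡a = ⊥-elim (v≢a v≡a)
  ... | no  _ with v ≟ b
  ...   | yes v≡b = ⊥-elim (v≢b v≡b)
  ...   | no  _   = refl

  at-second : ∀ {a b d r v} → v ≢ a → v ≡ b → cycle _≟_ (a ∷ b ∷ d ∷ r) v ≡ d
  at-second {a} {b} {v = v} v≢a v≡b with v ≟ a
  ... | yes v≡a = ⊥-elim (v≢a v≡a)
  ... | no  _ with v ≟ b
  ...   | yes _   = refl
  ...   | no  v≢b = ⊥-elim (v≢b v≡b)

  skip : ∀ {a b d r v} → v ≢ a → v ≢ b →
         cycle _≟_ (a ∷ b ∷ d ∷ r) v ≡ cycle _≟_ (a ∷ d ∷ r) v
  skip {a} {b} {v = v} v≢a v≢b with v ≟ a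
  ... | yes v≡a = ⊥-elim (v≢a v≡a)
  ... | no  _ with v ≟ b
  ...   | yes v≡b = ⊥-elim (v≢b v≡b)
  ...   | no  _   = refl

  cycle-fixes : ∀ l {v} → v ∉ l → cycle _≟_ l v ≡ v
  cycle-fixes []              _  = refl
  cycle-fixes (a ∷ [])        _  = singleton
  cycle-fixes (a ∷ b ∷ [])    v∉ = pair-off (v∉ ∘ here) (v∉ ∘ there ∘ here)
  cycle-fixes (a ∷ b ∷ d ∷ r) v∉ =
    trans (skip (v∉ ∘ here) (v∉ ∘ there ∘ here)) (cycle-fixes (a ∷ d ∷ r) (v∉ ∘ skip-second))
    where
    skip-second : ∀ {x} → x ∈ a ∷ d ∷ r → x ∈ a ∷ b ∷ d ∷ r
    skip-second (here x≡a) = here x≡a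
    skip-second (there x∈) = there (there x∈)

module _ {V W : Set} (_≟V_ : DecidableEquality V) (_≟W_ : DecidableEquality W)
  (φ : V → W) (φ-injective : ∀ {x y} → φ x ≡ φ y → x ≡ y) where

  private
    module CV = CycleEquations _≟V_
    module CW = CycleEquations _≟W_

  cycle-map : ∀ l v → cycle _≟W_ (map φ l) (φ v) ≡ φ (cycle _≟V_ l v)
  cycle-map []          v = refl
  cycle-map (a ∷ [])    v = trans CW.singleton (cong φ (≡-sym CV.singleton))
  cycle-map (a ∷ b ∷ r) v = by-head (v ≟V a)
    where
    by-head : Dec (v ≡ a) → cycle _≟W_ (map φ (a ∷ b ∷ r)) (φ v) ≡ φ (cycle _≟V_ (a ∷ b ∷ r) v)
    by-head (yes v≡a) = trans (CW.at-head (cong φ v≡a)) (cong φ (≡-sym (CV.at-head v≡a)))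
    by-head (no  v≢a) = off-head b r (v ≟V b)
      where
      φv≢φa : φ v ≢ φ a
      φv≢φa = v≢a ∘ φ-injective

      off-head : ∀ b r → Dec (v ≡ b) →
                 cycle _≟W_ (map φ (a ∷ b ∷ r)) (φ v) ≡ φ (cycle _≟V_ (a ∷ b ∷ r) v)
      off-head b []      (yes v≡b) =
        trans (CW.pair-at-second φv≢φa (cong φ v≡b)) (cong φ (≡-sym (CV.pair-at-second v≢a v≡b)))
      off-head b []      (no  v≢b) =
        trans (CW.pair-off φv≢φa (v≢b ∘ φ-injective)) (cong φ (≡-sym (CV.pair-off v≢a v≢b)))
      off-head b (d ∷ r) (yes v≡b) =
        trans (CW.at-second φv≢φa (cong φ v≡b)) (cong φ (≡-sym (CV.at-second v≢a v≡b)))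
      off-head b (d ∷ r) (no  v≢b) =
        trans (CW.skip φv≢φa (v≢b ∘ φ-injective))
              (trans (off-head d r (v ≟V d)) (cong φ (≡-sym (CV.skip v≢a v≢b))))

module ColouredForest {n m : ℕ} (F : Graph (Fin n)) (c : Fin n → Fin m)
  (edge-monochrome : ∀ {u v} → Adj F u v → c u ≡ c v) where

  open CycleEquations (FinP._≟_ {n}) using (cycle-fixes)

  P : Fin m → Set
  P j = Part c j

  T : (j : Fin m) → Graph (P j)
  T j = induced F c j

  InGF : (Fin n → Fin n) → Set
  InGF = InChainGroup FinP._≟_ F

  InGT : ∀ j → (P j → P j) → Set
  InGT j = InChainGroup (Part-≟ c j) (T j)

  cycleF : List (Fin n) → Fin n → Fin n
  cycleF = cycle FinP._≟_

  cycleT : ∀ j → List (P j) → P j → P j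
  cycleT j = cycle (Part-≟ c j)

  colour-irrelevant : ∀ {v j} (p q : c v ≡ j) → p ≡ q
  colour-irrelevant = UIP.Decidable⇒UIP.≡-irrelevant FinP._≟_

  part-≡ : ∀ {j} {x y : P j} → proj₁ x ≡ proj₁ y → x ≡ y
  part-≡ {x = v , p} {.v , q} refl = cong (v ,_) (colour-irrelevant p q)

  ∈-lower : ∀ {j} {lp : List (P j)} {y} → proj₁ y ∈ map proj₁ lp → y ∈ lp
  ∈-lower {lp = lp} y∈ with ∈-map⁻ proj₁ y∈
  ... | x , x∈ , y≡x = subst (_∈ lp) (≡-sym (part-≡ y≡x)) x∈

  Monochrome : Fin m → List (Fin n) → Set
  Monochrome j l = ∀ {v} → v ∈ l → c v ≡ j

  labels-monochrome : ∀ {j} (lp : List (P j)) → Monochrome j (map proj₁ lp)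
  labels-monochrome lp v∈ with ∈-map⁻ proj₁ v∈
  ... | y , _ , v≡y = trans (cong c v≡y) (proj₂ y)

  lift : ∀ {j} l → Monochrome j l → Σ (List (P j)) λ lp → map proj₁ lp ≡ l
  lift []      _    = [] , refl
  lift (v ∷ l) mono with lift l (mono ∘ there)
  ... | lp , lp≡l = (v , mono (here refl)) ∷ lp , cong (v ∷_) lp≡l

  linked-monochrome : ∀ a t → Linked F (a ∷ t) → Monochrome (c a) (a ∷ t)
  linked-monochrome a []      _        (here refl) = refl
  linked-monochrome a (b ∷ t) _        (here refl) = refl
  linked-monochrome a (b ∷ t) (ab , L) (there v∈) =
    trans (linked-monochrome b t L v∈) (≡-sym (edge-monochrome ab))

  path-monochrome : ∀ {j q v} → IsPath F q → v ∈ q → c v ≡ j → Monochrome j q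
  path-monochrome {q = a ∷ t} (_ , _ , L) v∈ cv≡j u∈ =
    trans (linked-monochrome a t L u∈) (trans (≡-sym (linked-monochrome a t L v∈)) cv≡j)

  linked-labels : ∀ {j} (lp : List (P j)) → Linked (T j) lp ≡ Linked F (map proj₁ lp)
  linked-labels []           = refl
  linked-labels (x ∷ [])     = refl
  linked-labels (x ∷ y ∷ lp) = cong (Adj F (proj₁ x) (proj₁ y) ×_) (linked-labels (y ∷ lp))

  path-raise : ∀ {j} (lp : List (P j)) → IsPath (T j) lp → IsPath F (map proj₁ lp)
  path-raise (x ∷ lp) (nonEmpty , U , L) =
    nonEmpty , UniqueP.map⁺ part-≡ U , subst id (linked-labels (x ∷ lp)) L

  path-lower : ∀ {j} (lp : List (P j)) → IsPath F (map proj₁ lp) → IsPath (T j) lp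
  path-lower (x ∷ lp) (nonEmpty , U , L) =
    nonEmpty , UniqueP.map⁻ U , subst id (≡-sym (linked-labels (x ∷ lp))) L

  -- A path of a part is maximal there iff its labels form a maximal path of F:
  -- an extension in the part is an extension in F, and an extension in F is
  -- monochrome and hence an extension in the part.
  maximal-lower : ∀ {j} (lp : List (P j)) → IsMaximalPath F (map proj₁ lp) → IsMaximalPath (T j) lp
  maximal-lower lp (path , no-extension) =
    path-lower lp path ,
    λ { (qp , qp-path , lp⊆qp , w , w∈qp , w∉lp) →
        no-extension (map proj₁ qp , path-raise qp qp-path , Subset.map⁺ proj₁ lp⊆qp ,
                      proj₁ w , ∈-map⁺ proj₁ w∈qp , w∉lp ∘ ∈-lower) }

  maximal-raise : ∀ {j} (lp : List (P j)) → IsMaximalPath (T j) lp → IsMaximalPath F (map proj₁ lp)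
  maximal-raise {j} (x ∷ lp) (path , no-extension) = path-raise (x ∷ lp) path , no-extension′
    where
    no-extension′ : ¬ (Σ (List (Fin n)) λ q → IsPath F q × map proj₁ (x ∷ lp) ⊆ q
                                             × ∃[ w ] (w ∈ q × w ∉ map proj₁ (x ∷ lp)))
    no-extension′ (q , q-path , sub , w , w∈q , w∉)
      with lift q (path-monochrome q-path (sub (here refl)) (proj₂ x))
    ... | qp , refl with ∈-map⁻ proj₁ w∈q
    ... | wp , wp∈qp , refl =
      no-extension (qp , path-lower qp q-path , ∈-lower ∘ sub ∘ ∈-map⁺ proj₁ ,
                    wp , wp∈qp , w∉ ∘ ∈-map⁺ proj₁)

  generator-view : ∀ {l} → IsMaximalPath F l →
    Σ (Fin m) λ j → Σ (List (P j)) λ lp → map proj₁ lp ≡ l × IsMaximalPath (T j) lp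
  generator-view {a ∷ t} max@((_ , _ , L) , _) with lift (a ∷ t) (linked-monochrome a t L)
  ... | lp , lp≡l = c a , lp , lp≡l , maximal-lower lp (subst (IsMaximalPath F) (≡-sym lp≡l) max)

  extend : ∀ j → (P j → P j) → Fin n → Fin n
  extend j g v with c v FinP.≟ j
  ... | yes cv≡j = proj₁ (g (v , cv≡j))
  ... | no  _    = v

  extend-inside : ∀ {j} g {v} (cv≡j : c v ≡ j) → extend j g v ≡ proj₁ (g (v , cv≡j))
  extend-inside {j} g {v} cv≡j with c v FinP.≟ j
  ... | yes cv≡j′ = cong (λ e → proj₁ (g (v , e))) (colour-irrelevant cv≡j′ cv≡j)
  ... | no  cv≢j  = ⊥-elim (cv≢j cv≡j)

  extend-outside : ∀ {j} g {v} → c v ≢ j → extend j g v ≡ v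
  extend-outside {j} g {v} cv≢j with c v FinP.≟ j
  ... | yes cv≡j = ⊥-elim (cv≢j cv≡j)
  ... | no  _    = refl

  extend-colour : ∀ j g v → c (extend j g v) ≡ c v
  extend-colour j g v with c v FinP.≟ j
  ... | yes cv≡j = trans (proj₂ (g (v , cv≡j))) (≡-sym cv≡j)
  ... | no  _    = refl

  extend-cong : ∀ j {f g} → f ≗ g → extend j f ≗ extend j g
  extend-cong j f≗g v with c v FinP.≟ j
  ... | yes cv≡j = cong proj₁ (f≗g (v , cv≡j))
  ... | no  _    = refl

  extend-id : ∀ j → extend j id ≗ id
  extend-id j v with c v FinP.≟ j
  ... | yes _ = refl
  ... | no  _ = refl

  extend-∘ : ∀ j f g → extend j (f ∘ g) ≗ extend j f ∘ extend j g
  extend-∘ j f g v with c v FinP.≟ j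
  ... | yes cv≡j = ≡-sym (extend-inside f (proj₂ (g (v , cv≡j))))
  ... | no  cv≢j = ≡-sym (extend-outside f cv≢j)

  cycle-labels : ∀ {j} (lp : List (P j)) w → cycleF (map proj₁ lp) (proj₁ w) ≡ proj₁ (cycleT j lp w)
  cycle-labels {j} = cycle-map (Part-≟ c j) FinP._≟_ proj₁ part-≡

  cycle-extension : ∀ {j} (lp : List (P j)) → cycleF (map proj₁ lp) ≗ extend j (cycleT j lp)
  cycle-extension {j} lp v with c v FinP.≟ j
  ... | yes cv≡j = cycle-labels lp (v , cv≡j)
  ... | no  cv≢j = cycle-fixes (map proj₁ lp) (cv≢j ∘ labels-monochrome lp)

  ColourPreserving : (Fin n → Fin n) → Set
  ColourPreserving f = ∀ v → c (f v) ≡ c v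

  -- Every element of G_F preserves colours: generators are extensions.
  chain-colour : ∀ {f} → InGF f → ColourPreserving f
  chain-colour (gen l max) v with generator-view max
  ... | j , lp , refl , _ = trans (cong c (cycle-extension lp v)) (extend-colour j (cycleT j lp) v)
  chain-colour one                    v = refl
  chain-colour (comp {g = g} pf pg)   v = trans (chain-colour pf (g v)) (chain-colour pg v)
  chain-colour (inv {g = g} pf fg≗ _) v = trans (≡-sym (chain-colour pf (g v))) (cong c (fg≗ v))
  chain-colour (ext pf f≗g)           v = trans (cong c (≡-sym (f≗g v))) (chain-colour pf v)

  restrict : ∀ f → ColourPreserving f → ∀ j → P j → P j
  restrict f pres j (v , cv≡j) = f v , trans (pres v) cv≡j

  -- Restriction maps G_F into G_{T_j}: a generator restricts to a generator
  -- of T_j or to the identity.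
  restrict-member : ∀ {f} → InGF f → ∀ pres j → InGT j (restrict f pres j)
  restrict-member (gen l max) pres j′ with generator-view max
  ... | j , lp , refl , max-lp with j FinP.≟ j′
  ...   | yes refl = ext (gen lp max-lp) λ w → part-≡ (≡-sym (cycle-labels lp w))
  ...   | no  j≢j′ = ext one λ w → part-≡ (≡-sym (cycle-fixes (map proj₁ lp)
                       λ v∈ → j≢j′ (trans (≡-sym (labels-monochrome lp v∈)) (proj₂ w))))
  restrict-member one          _ j = ext one λ _ → part-≡ refl
  restrict-member (comp pf pg) _ j =
    ext (comp (restrict-member pf (chain-colour pf) j) (restrict-member pg (chain-colour pg) j))
        λ _ → part-≡ refl
  restrict-member (inv pf fg≗ gf≗) _ j =
    inv (restrict-member pf (chain-colour pf) j)
        (λ w → part-≡ (fg≗ (proj₁ w))) (λ w → part-≡ (gf≗ (proj₁ w)))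
  restrict-member (ext pf f≗g) _ j =
    ext (restrict-member pf (chain-colour pf) j) λ w → part-≡ (f≗g (proj₁ w))

  -- Extension maps G_{T_j} into G_F: generators extend to generators.
  extend-member : ∀ j {g} → InGT j g → InGF (extend j g)
  extend-member j (gen lp max) = ext (gen (map proj₁ lp) (maximal-raise lp max)) (cycle-extension lp)
  extend-member j one = ext one λ v → ≡-sym (extend-id j v)
  extend-member j (comp {f} {g} pf pg) =
    ext (comp (extend-member j pf) (extend-member j pg)) λ v → ≡-sym (extend-∘ j f g v)
  extend-member j (inv {f} {g} pf fg≗ gf≗) =
    inv (extend-member j pf)
        (λ v → trans (≡-sym (extend-∘ j f g v)) (trans (extend-cong j fg≗ v) (extend-id j v)))
        (λ v → trans (≡-sym (extend-∘ j g f v)) (trans (extend-cong j gf≗ v) (extend-id j v)))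
  extend-member j (ext pf f≗g) = ext (extend-member j pf) (extend-cong j f≗g)

  module Gluing (g : ∀ j → P j → P j) (g-member : ∀ j → InGT j (g j)) where

    glue : Fin n → Fin n
    glue v = proj₁ (g (c v) (v , refl))

    glue-at : ∀ {j v} (cv≡j : c v ≡ j) → glue v ≡ proj₁ (g j (v , cv≡j))
    glue-at refl = refl

    glue-colour : ColourPreserving glue
    glue-colour v = proj₂ (g (c v) (v , refl))

    extend-all : List (Fin m) → Fin n → Fin n
    extend-all []       = id
    extend-all (j ∷ js) = extend j (g j) ∘ extend-all js

    extend-all-member : ∀ js → InGF (extend-all js)
    extend-all-member []       = one
    extend-all-member (j ∷ js) = comp (extend-member j (g-member j)) (extend-all-member js)

    extend-all-outside : ∀ js {v} → c v ∉ js → extend-all js v ≡ v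
    extend-all-outside []       _   = refl
    extend-all-outside (j ∷ js) cv∉ =
      trans (cong (extend j (g j)) (extend-all-outside js (cv∉ ∘ there))) (extend-outside (g j) (cv∉ ∘ here))

    -- over a list without repetitions, exactly one factor acts on each vertex
    extend-all-inside : ∀ {js} → Unique js → ∀ {v} → c v ∈ js → extend-all js v ≡ glue v
    extend-all-inside {j ∷ js} (j≢js ∷ _) {v} (here cv≡j) =
      trans (cong (extend j (g j)) (extend-all-outside js cv∉js))
            (trans (extend-inside (g j) cv≡j) (≡-sym (glue-at cv≡j)))
      where
      cv∉js : c v ∉ js
      cv∉js cv∈ = All.lookup j≢js cv∈ (≡-sym cv≡j)
    extend-all-inside {j ∷ js} (j≢js ∷ js-unique) {v} (there cv∈) =
      trans (cong (extend j (g j)) (extend-all-inside js-unique cv∈))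
            (extend-outside (g j) λ glue≡j → All.lookup j≢js cv∈ (trans (≡-sym glue≡j) (glue-colour v)))

    glue-member : InGF glue
    glue-member =
      ext (extend-all-member (allFin m)) λ v → extend-all-inside (UniqueP.allFin⁺ m) (∈-allFin (c v))

  -- Restriction to all parts: a homomorphism, injective since every vertex lies
  -- in its own part, surjective by gluing.
  iso : ChainGroupIso F c
  iso = record
    { to         = to
    ; to-cong    = λ x≈y j w → part-≡ (x≈y (proj₁ w))
    ; homo       = λ _ _ _ _ → part-≡ refl
    ; injective  = λ tox≈toy v → cong proj₁ (tox≈toy (c v) (v , refl))
    ; surjective = λ z → let open Gluing (proj₁ ∘ z) (proj₂ ∘ z) in
                     (glue , glue-member) , λ j w → part-≡ (glue-at (proj₂ w))
    }
    where
    to : GF F c → Product F c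
    to (f , pf) j = restrict f (chain-colour pf) j , restrict-member pf (chain-colour pf) j

mainTheorem2 : (n : ℕ) (F : Graph (Fin n)) → IsForest F →
    (m : ℕ) (c : Fin n → Fin m) →
    (∀ j → ∃[ v ] c v ≡ j) →
    (∀ {u v} → Adj F u v → c u ≡ c v) →
    (∀ j → IsTree (induced F c j)) →
    ChainGroupIso F c
mainTheorem2 n F _ m c _ edge-monochrome _ = ColouredForest.iso F c edge-monochrome
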